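{- Let $\mathbf u$ be a sequence of transpositions in $\mathrm{Sym}(3)$ such that the union of the supports of its terms is $\{0,1,2\}$. Then $\mathbf u$ is conjugacy invariant if and only if either $|\mathbf u|$ is odd or $\mathcal T(\mathbf u)$ is a multitree with at least one simple multiedge.
   Context: Permutations compose left to right. For a finite sequence $\mathbf s$ in $\mathrm{Sym}(3)$, $|\mathbf s|$ is its length, $\bigcirc\mathbf s$ the composite of its terms in order, $\mathrm{Seq}(\mathbf s)$ its set of rearrangements and $\mathrm{Prod}(\mathbf s)=\{\bigcirc\mathbf r:\mathbf r\in\mathrm{Seq}(\mathbf s)\}$; $\mathbf s$ is conjugacy invariant iff every element of $\mathrm{Prod}(\mathbf s)$ is conjugate to $\bigcirc\mathbf s$. $\mathcal T(\mathbf u)$ is the multigraph on vertex set $\{0,1,2\}$ in which the multiedge $(x\,y)$ has multiplicity equal to the number of terms of $\mathbf u$ equal to $(x\,y)$; a multiedge is simple if its multiplicity is $1$; a multitree is a multigraph whose underlying simple graph is a tree. -}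

module Defs where

open import Data.Nat using (ℕ; _≤_; _≡ᵇ_)
open import Data.Fin using (Fin)
open import Data.Fin.Properties using (all?)
import Data.Fin.Properties as FinP
open import Data.Fin.Permutation using (Permutation′; _⟨$⟩ʳ_; _∘ₚ_; flip; transpose; id)
open import Data.List using (List; []; _∷_; foldr; length; map; filter)
open import Data.List.Relation.Binary.Permutation.Propositional using (_↭_)
open import Data.List.Membership.Propositional using (_∈_)
open import Data.List.Relation.Unary.Unique.Propositional using (Unique)
open import Data.List.Relation.Unary.All using (All)
open import Data.Product using (Σ; ∃; _×_; _,_)
open import Relation.Binary.PropositionalEquality using (_≡_; _≢_)
open import Relation.Binary.Construct.Closure.ReflexiveTransitive using (Star)
open import Relation.Nullary using (Dec; ¬_)
open import Relation.Unary using (Pred)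

Sym3 : Set
Sym3 = Permutation′ 3

_≈ₚ_ : Sym3 → Sym3 → Set
σ ≈ₚ τ = ∀ i → σ ⟨$⟩ʳ i ≡ τ ⟨$⟩ʳ i

_≈ₚ?_ : (σ τ : Sym3) → Dec (σ ≈ₚ τ)
σ ≈ₚ? τ = all? (λ i → σ ⟨$⟩ʳ i FinP.≟ τ ⟨$⟩ʳ i)

IsTransposition : Sym3 → Set
IsTransposition σ = Σ (Fin 3) λ x → Σ (Fin 3) λ y → x ≢ y × σ ≈ₚ transpose x y

InSupport : Fin 3 → Sym3 → Set
InSupport i σ = σ ⟨$⟩ʳ i ≢ i

-- composite of the terms in order, composing left to right
-- (σ ∘ₚ τ applies σ first, then τ)
composite : List Sym3 → Sym3
composite = foldr _∘ₚ_ id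

Conjugate : Sym3 → Sym3 → Set
Conjugate σ τ = Σ Sym3 λ g → (flip g ∘ₚ σ ∘ₚ g) ≈ₚ τ

InProd : Sym3 → List Sym3 → Set
InProd π s = Σ (List Sym3) λ r → r ↭ s × π ≈ₚ composite r

ConjugacyInvariant : List Sym3 → Set
ConjugacyInvariant s = ∀ π → InProd π s → Conjugate π (composite s)

-- multiplicity of the multiedge (x y) in T(u): number of terms equal to (x y)
multiplicity : List Sym3 → Fin 3 → Fin 3 → ℕ
multiplicity u x y = length (filter (λ σ → σ ≈ₚ? transpose x y) u)

-- underlying simple graph of T(u): x ~ y iff x ≠ y and (x y) occurs in u
Adj : List Sym3 → Fin 3 → Fin 3 → Set
Adj u x y = x ≢ y × 1 ≤ multiplicity u x y

Connected : {n : ℕ} → (Fin n → Fin n → Set) → Set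
Connected E = ∀ x y → Star E x y

Walk : {n : ℕ} → (Fin n → Fin n → Set) → Fin n → List (Fin n) → Fin n → Set
Walk E x [] y = E x y
Walk E x (z ∷ zs) y = E x z × Walk E z zs y

record Cycle {n : ℕ} (E : Fin n → Fin n → Set) : Set where
  field
    start : Fin n
    rest  : List (Fin n)
    long  : 2 ≤ length rest
    dist  : Unique (start ∷ rest)
    walk  : Walk E start rest start

Acyclic : {n : ℕ} → (Fin n → Fin n → Set) → Set
Acyclic E = ¬ Cycle E

IsTree : {n : ℕ} → (Fin n → Fin n → Set) → Set
IsTree E = Connected E × Acyclic E

IsMultitree : List Sym3 → Set
IsMultitree u = IsTree (Adj u)

HasSimpleMultiedge : List Sym3 → Set
HasSimpleMultiedge u = Σ (Fin 3) λ x → Σ (Fin 3) λ y → x ≢ y × multiplicity u x y ≡ 1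

module Submission where

-- A permutation of {0,1,2} is read as an element of a concrete
-- six-element model of Sym(3), where every identity we need is a finite fact
-- checked by exhaustive evaluation of a decision procedure.  Conjugacy
-- classes of Sym(3) are determined by the number of fixed points, so u is
-- conjugacy invariant iff all rearrangements of its list of kinds (the
-- transpositions it consists of) multiply to elements with equally many fixed
-- points.  A product of n transpositions has sign parity(n).  For |u| odd all
-- products are transpositions.  For |u| even all products are even; if all
-- three transpositions occur (T(u) contains a triangle), or two of them occur
-- at least twice, three explicit rearrangements land in different classes.
-- Otherwise T(u) is a path with a simple multiedge x, and every rearrangement
-- multiplies to y^a x y^b with a, b ∈ {0,1}, always a 3-cycle.

open import Defs
open import Data.Nat using (ℕ)
open import Data.Nat.Base using (_%_)
open import Data.Fin using (Fin)
open import Data.List using (List; length)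
open import Data.List.Membership.Propositional using (_∈_)
open import Data.List.Relation.Unary.All using (All)
open import Data.Product using (Σ; _×_)
open import Data.Sum using (_⊎_)
open import Relation.Binary.PropositionalEquality using (_≡_)
open import Function.Bundles using (_⇔_)

open import Data.Nat.Base using (suc; _≤_; z≤n; s≤s; s≤s⁻¹; parity)
import Data.Nat.Properties as ℕ
open import Data.Fin.Patterns using (0F; 1F; 2F; 3F; 4F; 5F)
open import Data.Fin.Properties using (_≟_; all?; any?)
open import Data.Fin.Permutation using (_⟨$⟩ʳ_; _⟨$⟩ˡ_; _∘ₚ_; flip; transpose; id; permutation; inverseˡ)
open import Data.List.Base using ([]; _∷_; _++_; filter; allFin; foldr; map)
open import Data.List.Properties using (filter-accept; filter-reject; length-map)
open import Data.List.Relation.Unary.All using ([]; _∷_)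
import Data.List.Relation.Unary.All as All
import Data.List.Relation.Unary.All.Properties as AllP
open import Data.List.Relation.Unary.Any using (here; there)
open import Data.List.Membership.Propositional.Properties using (∈-map⁺)
open import Data.List.Relation.Unary.AllPairs using ([]; _∷_)
open import Data.List.Relation.Binary.Permutation.Propositional using (_↭_; ↭-refl; ↭-sym; ↭-trans; prep; swap)
import Data.List.Relation.Binary.Permutation.Propositional.Properties as ↭
open import Data.Parity.Base using (Parity; 0ℙ; 1ℙ; _+_; _⁻¹)
import Data.Parity.Properties as ℙ
open import Data.Product using (∃; ∃₂; _,_; proj₁; proj₂)
open import Data.Sum using (inj₁; inj₂; [_,_]′)
open import Data.Empty using (⊥; ⊥-elim)
open import Function.Bundles using (mk⇔; Equivalence)
open import Relation.Binary.Construct.Closure.ReflexiveTransitive using (Star; ε; _◅_; _◅◅_)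
open import Relation.Nullary using (Dec; ¬_; yes; no)
open import Relation.Nullary.Decidable using (from-yes; _×-dec_; _⊎-dec_; _→-dec_; ¬?)
open import Relation.Binary.PropositionalEquality using (_≢_; refl; sym; trans; cong; cong₂; subst; module ≡-Reasoning)

-- The model of Sym(3), carried by Fin 6 so that equality and quantification
-- over its elements are decidable: e is the identity, tᵢⱼ the transposition
-- (i j) and c₀₁₂, c₀₂₁ the 3-cycles 0↦1↦2↦0 and 0↦2↦1↦0.
S3 : Set
S3 = Fin 6

pattern e    = 0F
pattern t₀₁  = 1F
pattern t₀₂  = 2F
pattern t₁₂  = 3F
pattern c₀₁₂ = 4F
pattern c₀₂₁ = 5F

ap : S3 → Fin 3 → Fin 3
ap e    i  = i
ap t₀₁  0F = 1F
ap t₀₁  1F = 0F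
ap t₀₁  2F = 2F
ap t₀₂  0F = 2F
ap t₀₂  1F = 1F
ap t₀₂  2F = 0F
ap t₁₂  0F = 0F
ap t₁₂  1F = 2F
ap t₁₂  2F = 1F
ap c₀₁₂ 0F = 1F
ap c₀₁₂ 1F = 2F
ap c₀₁₂ 2F = 0F
ap c₀₂₁ 0F = 2F
ap c₀₂₁ 1F = 0F
ap c₀₂₁ 2F = 1F

-- The element with images a and b of 0 and 1 (meaningful when a ≢ b).
decode : Fin 3 → Fin 3 → S3
decode 0F 1F = e
decode 1F 0F = t₀₁
decode 2F 1F = t₀₂
decode 0F 2F = t₁₂
decode 1F 2F = c₀₁₂
decode 2F 0F = c₀₂₁
decode _  _  = e

-- Left-to-right product: mul p q applies p first, then q.
mul : S3 → S3 → S3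
mul p q = decode (ap q (ap p 0F)) (ap q (ap p 1F))

inv : S3 → S3
inv c₀₁₂ = c₀₂₁
inv c₀₂₁ = c₀₁₂
inv p    = p

fixedPoints : S3 → ℕ
fixedPoints p = length (filter (λ i → ap p i ≟ i) (allFin 3))

sign : S3 → Parity
sign t₀₁ = 1ℙ
sign t₀₂ = 1ℙ
sign t₁₂ = 1ℙ
sign _   = 0ℙ

Transp : S3 → Set
Transp p = fixedPoints p ≡ 1

transp? : ∀ p → Dec (Transp p)
transp? p = fixedPoints p ℕ.≟ 1

-- Each fact about the model below is proved by `from-yes`: its decision
-- procedure, built from all?/any? over Fin 6 and Fin 3, evaluates to yes.

decode-images : ∀ a b c → a ≢ b → a ≢ c → b ≢ c →
  ap (decode a b) 0F ≡ a × ap (decode a b) 1F ≡ b × ap (decode a b) 2F ≡ c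
decode-images = from-yes (all? λ a → all? λ b → all? λ c →
  ¬? (a ≟ b) →-dec ¬? (a ≟ c) →-dec ¬? (b ≟ c) →-dec
  (ap (decode a b) 0F ≟ a ×-dec ap (decode a b) 1F ≟ b ×-dec ap (decode a b) 2F ≟ c))

decode-ap : ∀ p → decode (ap p 0F) (ap p 1F) ≡ p
decode-ap = from-yes (all? λ p → decode (ap p 0F) (ap p 1F) ≟ p)

ap-mul : ∀ p q i → ap (mul p q) i ≡ ap q (ap p i)
ap-mul = from-yes (all? λ p → all? λ q → all? λ i → ap (mul p q) i ≟ ap q (ap p i))

ap-inv-right : ∀ p i → ap p (ap (inv p) i) ≡ i
ap-inv-right = from-yes (all? λ p → all? λ i → ap p (ap (inv p) i) ≟ i)

ap-inv-left : ∀ p i → ap (inv p) (ap p i) ≡ i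
ap-inv-left = from-yes (all? λ p → all? λ i → ap (inv p) (ap p i) ≟ i)

mul-identityˡ : ∀ p → mul e p ≡ p
mul-identityˡ = from-yes (all? λ p → mul e p ≟ p)

mul-assoc : ∀ p q r → mul (mul p q) r ≡ mul p (mul q r)
mul-assoc = from-yes (all? λ p → all? λ q → all? λ r → mul (mul p q) r ≟ mul p (mul q r))

fixedPoints-conj : ∀ k p → fixedPoints (mul (inv k) (mul p k)) ≡ fixedPoints p
fixedPoints-conj = from-yes (all? λ k → all? λ p →
  fixedPoints (mul (inv k) (mul p k)) ℕ.≟ fixedPoints p)

conjugator : ∀ p q → fixedPoints p ≡ fixedPoints q → ∃ λ k → mul (inv k) (mul p k) ≡ q
conjugator = from-yes (all? λ p → all? λ q →
  fixedPoints p ℕ.≟ fixedPoints q →-dec any? λ k → mul (inv k) (mul p k) ≟ q)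

sign-mul : ∀ p q → sign (mul p q) ≡ sign p + sign q
sign-mul = from-yes (all? λ p → all? λ q → sign (mul p q) ℙ.≟ sign p + sign q)

sign-transp : ∀ p → Transp p → sign p ≡ 1ℙ
sign-transp = from-yes (all? λ p → transp? p →-dec sign p ℙ.≟ 1ℙ)

odd⇒transp : ∀ p → sign p ≡ 1ℙ → Transp p
odd⇒transp = from-yes (all? λ p → sign p ℙ.≟ 1ℙ →-dec transp? p)

code : Sym3 → S3
code σ = decode (σ ⟨$⟩ʳ 0F) (σ ⟨$⟩ʳ 1F)

-- σ is injective, so its images of 0, 1, 2 are distinct and code σ acts as σ.
code-correct : ∀ σ i → σ ⟨$⟩ʳ i ≡ ap (code σ) i
code-correct σ = agree
  where
    separate : ∀ {i j} → i ≢ j → σ ⟨$⟩ʳ i ≢ σ ⟨$⟩ʳ j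
    separate {i} {j} i≢j σi≡σj = i≢j (begin
      i                       ≡⟨ sym (inverseˡ σ) ⟩
      σ ⟨$⟩ˡ (σ ⟨$⟩ʳ i)      ≡⟨ cong (σ ⟨$⟩ˡ_) σi≡σj ⟩
      σ ⟨$⟩ˡ (σ ⟨$⟩ʳ j)      ≡⟨ inverseˡ σ ⟩
      j                       ∎)
      where open ≡-Reasoning
    images = decode-images (σ ⟨$⟩ʳ 0F) (σ ⟨$⟩ʳ 1F) (σ ⟨$⟩ʳ 2F)
               (separate (λ ())) (separate (λ ())) (separate (λ ()))
    agree : ∀ i → σ ⟨$⟩ʳ i ≡ ap (code σ) i
    agree 0F = sym (proj₁ images)
    agree 1F = sym (proj₁ (proj₂ images))
    agree 2F = sym (proj₂ (proj₂ images))

code-unique : ∀ σ {p} → (∀ i → σ ⟨$⟩ʳ i ≡ ap p i) → code σ ≡ p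
code-unique σ {p} acts = trans (cong₂ decode (acts 0F) (acts 1F)) (decode-ap p)

≈ₚ⇔code : ∀ σ τ → σ ≈ₚ τ ⇔ code σ ≡ code τ
≈ₚ⇔code σ τ = mk⇔
  (λ σ≈τ → code-unique σ λ i → trans (σ≈τ i) (code-correct τ i))
  (λ same i → trans (code-correct σ i) (trans (cong (λ p → ap p i) same) (sym (code-correct τ i))))

code-∘ : ∀ σ τ → code (σ ∘ₚ τ) ≡ mul (code σ) (code τ)
code-∘ σ τ = code-unique (σ ∘ₚ τ) λ i → begin
  τ ⟨$⟩ʳ (σ ⟨$⟩ʳ i)                ≡⟨ code-correct τ _ ⟩
  ap (code τ) (σ ⟨$⟩ʳ i)           ≡⟨ cong (ap (code τ)) (code-correct σ i) ⟩
  ap (code τ) (ap (code σ) i)      ≡⟨ sym (ap-mul (code σ) (code τ) i) ⟩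
  ap (mul (code σ) (code τ)) i     ∎
  where open ≡-Reasoning

code-flip : ∀ σ → code (flip σ) ≡ inv (code σ)
code-flip σ = code-unique (flip σ) λ i → begin
  σ ⟨$⟩ˡ i                                 ≡⟨ cong (σ ⟨$⟩ˡ_) (sym (σ-hits i)) ⟩
  σ ⟨$⟩ˡ (σ ⟨$⟩ʳ ap (inv (code σ)) i)      ≡⟨ inverseˡ σ ⟩
  ap (inv (code σ)) i                      ∎
  where
    open ≡-Reasoning
    σ-hits : ∀ i → σ ⟨$⟩ʳ ap (inv (code σ)) i ≡ i
    σ-hits i = trans (code-correct σ _) (ap-inv-right (code σ) i)

toPerm : S3 → Sym3
toPerm p = permutation (ap p) (ap (inv p)) (ap-inv-right p) (ap-inv-left p)

code-conj : ∀ g σ → code (flip g ∘ₚ σ ∘ₚ g) ≡ mul (inv (code g)) (mul (code σ) (code g))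
code-conj g σ = begin
  code (flip g ∘ₚ σ ∘ₚ g)                          ≡⟨ code-∘ (flip g) (σ ∘ₚ g) ⟩
  mul (code (flip g)) (code (σ ∘ₚ g))               ≡⟨ cong₂ mul (code-flip g) (code-∘ σ g) ⟩
  mul (inv (code g)) (mul (code σ) (code g))        ∎
  where open ≡-Reasoning

conjugate⇔fixedPoints : ∀ σ τ → Conjugate σ τ ⇔ fixedPoints (code σ) ≡ fixedPoints (code τ)
conjugate⇔fixedPoints σ τ = mk⇔ to from
  where
    to : Conjugate σ τ → fixedPoints (code σ) ≡ fixedPoints (code τ)
    to (g , conj≈τ) = trans (sym (fixedPoints-conj (code g) (code σ)))
      (cong fixedPoints (trans (sym (code-conj g σ)) (Equivalence.to (≈ₚ⇔code (flip g ∘ₚ σ ∘ₚ g) τ) conj≈τ)))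
    from : fixedPoints (code σ) ≡ fixedPoints (code τ) → Conjugate σ τ
    from same = conjugate-by (conjugator (code σ) (code τ) same)
      where
        conjugate-by : (∃ λ k → mul (inv k) (mul (code σ) k) ≡ code τ) → Conjugate σ τ
        conjugate-by (k , conj≡) = toPerm k ,
          Equivalence.from (≈ₚ⇔code (flip (toPerm k) ∘ₚ σ ∘ₚ toPerm k) τ) (trans (code-conj (toPerm k) σ)
            (trans (cong (λ h → mul (inv h) (mul (code σ) h)) (decode-ap k)) conj≡))

edge : Fin 3 → Fin 3 → S3
edge i j = code (transpose i j)

edge-transp : ∀ i j → i ≢ j → Transp (edge i j)
edge-transp = from-yes (all? λ i → all? λ j → ¬? (i ≟ j) →-dec transp? (edge i j))

edge-sym : ∀ i j → edge i j ≡ edge j i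
edge-sym = from-yes (all? λ i → all? λ j → edge i j ≟ edge j i)

edge-moves : ∀ i j → i ≢ j → ap (edge i j) i ≡ j
edge-moves = from-yes (all? λ i → all? λ j → ¬? (i ≟ j) →-dec ap (edge i j) i ≟ j)

edge-ends : ∀ p → Transp p → ∃₂ λ i j → i ≢ j × edge i j ≡ p
edge-ends = from-yes (all? λ p → transp? p →-dec any? λ i → any? λ j → ¬? (i ≟ j) ×-dec edge i j ≟ p)

transposition-code : ∀ {σ} → IsTransposition σ → Transp (code σ)
transposition-code {σ} (i , j , i≢j , σ≈) =
  subst Transp (sym (Equivalence.to (≈ₚ⇔code σ (transpose i j)) σ≈)) (edge-transp i j i≢j)

product : List S3 → S3
product = foldr mul e

kinds : List Sym3 → List S3
kinds = map code

code-composite : ∀ s → code (composite s) ≡ product (kinds s)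
code-composite []      = code-unique id λ _ → refl
code-composite (σ ∷ s) = trans (code-∘ σ (composite s)) (cong (mul (code σ)) (code-composite s))

Invariant : List S3 → Set
Invariant ks = ∀ rs → rs ↭ ks → fixedPoints (product rs) ≡ fixedPoints (product ks)

same-class : ∀ {ks rs ss} → Invariant ks → rs ↭ ks → ss ↭ ks →
  fixedPoints (product rs) ≡ fixedPoints (product ss)
same-class invariant rs↭ ss↭ = trans (invariant _ rs↭) (sym (invariant _ ss↭))

-- Conjugacy invariance of u depends only on its kinds, since every
-- rearrangement of kinds u is the list of kinds of a rearrangement of u.
invariant⇔ : ∀ u → ConjugacyInvariant u ⇔ Invariant (kinds u)
invariant⇔ u = mk⇔ to from
  where
    open ≡-Reasoning
    fixedPoints-composite : ∀ s → fixedPoints (code (composite s)) ≡ fixedPoints (product (kinds s))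
    fixedPoints-composite s = cong fixedPoints (code-composite s)
    to : ConjugacyInvariant u → Invariant (kinds u)
    to ci rs rs↭ with ↭.↭-map-inv code (↭-sym rs↭)
    ... | r , refl , u↭r = begin
      fixedPoints (product (kinds r))     ≡⟨ sym (fixedPoints-composite r) ⟩
      fixedPoints (code (composite r))    ≡⟨ Equivalence.to (conjugate⇔fixedPoints (composite r) (composite u))
                                               (ci (composite r) (r , ↭-sym u↭r , λ _ → refl)) ⟩
      fixedPoints (code (composite u))    ≡⟨ fixedPoints-composite u ⟩
      fixedPoints (product (kinds u))     ∎
    from : Invariant (kinds u) → ConjugacyInvariant u
    from invariant π (r , r↭u , π≈r) = Equivalence.from (conjugate⇔fixedPoints π (composite u)) (begin
      fixedPoints (code π)                ≡⟨ cong fixedPoints (Equivalence.to (≈ₚ⇔code π (composite r)) π≈r) ⟩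
      fixedPoints (code (composite r))    ≡⟨ fixedPoints-composite r ⟩
      fixedPoints (product (kinds r))     ≡⟨ invariant (kinds r) (↭.map⁺ code r↭u) ⟩
      fixedPoints (product (kinds u))     ≡⟨ sym (fixedPoints-composite u) ⟩
      fixedPoints (code (composite u))    ∎)

sign-product : ∀ {ks} → All Transp ks → sign (product ks) ≡ parity (length ks)
sign-product []                 = refl
sign-product {k ∷ ks} (tk ∷ ts) = begin
  sign (mul k (product ks))         ≡⟨ sign-mul k (product ks) ⟩
  sign k + sign (product ks)        ≡⟨ cong₂ _+_ (sign-transp k tk) (sign-product ts) ⟩
  1ℙ + parity (length ks)          ≡⟨ sym (ℙ.+-homo-+ 1 (length ks)) ⟩
  parity (suc (length ks))         ∎
  where open ≡-Reasoning

odd⇔parity : ∀ n → n % 2 ≡ 1 ⇔ parity n ≡ 1ℙ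
odd⇔parity 0             = mk⇔ (λ ()) (λ ())
odd⇔parity 1             = mk⇔ (λ _ → refl) (λ _ → refl)
odd⇔parity (suc (suc n)) = odd⇔parity n

parity-pred : ∀ n → parity (suc n) ≡ 0ℙ → parity n ≡ 1ℙ
parity-pred n even = trans (sym (ℙ.suc-homo-⁻¹ n)) (cong _⁻¹ even)

-- For odd length every rearrangement multiplies to a transposition.
odd-invariant : ∀ {ks} → All Transp ks → parity (length ks) ≡ 1ℙ → Invariant ks
odd-invariant {ks} ts odd rs rs↭ =
  trans (odd-transposition (↭.All-resp-↭ (↭-sym rs↭) ts) (trans (cong parity (↭.↭-length rs↭)) odd))
        (sym (odd-transposition ts odd))
  where
    odd-transposition : ∀ {rs} → All Transp rs → parity (length rs) ≡ 1ℙ → Transp (product rs)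
    odd-transposition {rs} trs odd = odd⇒transp (product rs) (trans (sign-product trs) odd)

count : S3 → List S3 → ℕ
count p ks = length (filter (_≟ p) ks)

count-↭ : ∀ p {ks rs} → ks ↭ rs → count p ks ≡ count p rs
count-↭ p ks↭rs = ↭.↭-length (↭.filter-↭ (_≟ p) ks↭rs)

count-here : ∀ {p q} ks → q ≡ p → count p (q ∷ ks) ≡ suc (count p ks)
count-here {p} _ q≡p = cong length (filter-accept (_≟ p) q≡p)

count-there : ∀ {p q} ks → q ≢ p → count p (q ∷ ks) ≡ count p ks
count-there _ q≢p = cong length (filter-reject (_≟ _) q≢p)

count-twice : ∀ p ks → count p (p ∷ p ∷ ks) ≡ suc (suc (count p ks))
count-twice p ks = trans (count-here (p ∷ ks) refl) (cong suc (count-here ks refl))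

count-skip-twice : ∀ {p q} ks → q ≢ p → count p (q ∷ q ∷ ks) ≡ count p ks
count-skip-twice ks q≢p = trans (count-there (_ ∷ ks) q≢p) (count-there ks q≢p)

member-counts : ∀ {p ks} → p ∈ ks → 1 ≤ count p ks
member-counts {p} {k ∷ ks} p∈ with k ≟ p | p∈
... | yes _  | _         = s≤s z≤n
... | no k≢p | here p≡k  = ⊥-elim (k≢p (sym p≡k))
... | no _   | there p∈′ = member-counts p∈′

absent : ∀ {p ks} → count p ks ≡ 0 → All (_≢ p) ks
absent {p} {[]}     _    = []
absent {p} {k ∷ ks} none with k ≟ p
... | yes _  = ⊥-elim (ℕ.0≢1+n (sym none))
... | no k≢p = k≢p ∷ absent none

pick : ∀ {p} ks → 1 ≤ count p ks → ∃ λ rs → ks ↭ p ∷ rs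
pick {p} (k ∷ ks) occurs with k ≟ p
... | yes refl = ks , ↭-refl
... | no _ with pick ks occurs
...   | rs , ks↭ = k ∷ rs , ↭-trans (prep k ks↭) (swap k p ↭-refl)

rearrange-prefix : ∀ ps ks → (∀ q → count q ps ≤ count q ks) → ∃ λ rs → ks ↭ ps ++ rs
rearrange-prefix []       ks _      = ks , ↭-refl
rearrange-prefix (p ∷ ps) ks enough = extend (pick ks p-occurs)
  where
    p-occurs : 1 ≤ count p ks
    p-occurs = ℕ.≤-trans (s≤s z≤n) (subst (_≤ count p ks) (count-here {p} ps refl) (enough p))
    cancel : ∀ {rs} q → count q (p ∷ ps) ≤ count q (p ∷ rs) → count q ps ≤ count q rs
    cancel q le with p ≟ q
    ... | yes _ = s≤s⁻¹ le
    ... | no _  = le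
    extend : (∃ λ rs → ks ↭ p ∷ rs) → ∃ λ rs → ks ↭ p ∷ ps ++ rs
    extend (rs , ks↭) =
      let rs′ , rs↭ = rearrange-prefix ps rs λ q → cancel q (subst (count q (p ∷ ps) ≤_) (count-↭ q ks↭) (enough q))
      in rs′ , ↭-trans ks↭ (prep p rs↭)

triangle-classes : ∀ t → Transp t →
  ¬ (fixedPoints (mul t₀₁ (mul t₀₂ (mul t₁₂ t))) ≡ fixedPoints (mul t₀₁ (mul t₁₂ (mul t₀₂ t))) ×
     fixedPoints (mul t₀₁ (mul t₀₂ (mul t₁₂ t))) ≡ fixedPoints (mul t₀₂ (mul t₀₁ (mul t₁₂ t))))
triangle-classes = from-yes (all? λ t → transp? t →-dec
  ¬? (fixedPoints (mul t₀₁ (mul t₀₂ (mul t₁₂ t))) ℕ.≟ fixedPoints (mul t₀₁ (mul t₁₂ (mul t₀₂ t))) ×-dec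
      fixedPoints (mul t₀₁ (mul t₀₂ (mul t₁₂ t))) ℕ.≟ fixedPoints (mul t₀₂ (mul t₀₁ (mul t₁₂ t)))))

triangle-obstruction : ∀ {ks} → All Transp ks → parity (length ks) ≡ 0ℙ →
  (∀ p → Transp p → 1 ≤ count p ks) → ¬ Invariant ks
triangle-obstruction {ks} ts even all-occur invariant = obstruct (rearrange-prefix (t₀₁ ∷ t₀₂ ∷ t₁₂ ∷ []) ks enough)
  where
    enough : ∀ q → count q (t₀₁ ∷ t₀₂ ∷ t₁₂ ∷ []) ≤ count q ks
    enough e    = z≤n
    enough t₀₁  = all-occur t₀₁ refl
    enough t₀₂  = all-occur t₀₂ refl
    enough t₁₂  = all-occur t₁₂ refl
    enough c₀₁₂ = z≤n
    enough c₀₂₁ = z≤n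
    obstruct : (∃ λ rs → ks ↭ t₀₁ ∷ t₀₂ ∷ t₁₂ ∷ rs) → ⊥
    obstruct (rs , ks↭) = triangle-classes (product rs) rest-transp (same-class invariant w₀ w₁ , same-class invariant w₀ w₂)
      where
        w₀ : t₀₁ ∷ t₀₂ ∷ t₁₂ ∷ rs ↭ ks
        w₀ = ↭-sym ks↭
        w₁ : t₀₁ ∷ t₁₂ ∷ t₀₂ ∷ rs ↭ ks
        w₁ = ↭-trans (prep t₀₁ (swap t₁₂ t₀₂ ↭-refl)) w₀
        w₂ : t₀₂ ∷ t₀₁ ∷ t₁₂ ∷ rs ↭ ks
        w₂ = ↭-trans (swap t₀₂ t₀₁ ↭-refl) w₀
        rest-transp : Transp (product rs)
        rest-transp = odd⇒transp (product rs) (trans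
          (sign-product (AllP.++⁻ʳ (t₀₁ ∷ t₀₂ ∷ t₁₂ ∷ []) (↭.All-resp-↭ ks↭ ts)))
          (parity-pred (length rs) (trans (cong parity (↭.↭-length w₀)) even)))

doubled-classes : ∀ x y ρ → Transp x → Transp y → x ≢ y → sign ρ ≡ 0ℙ →
  ¬ (fixedPoints (mul x (mul x (mul y (mul y ρ)))) ≡ fixedPoints (mul x (mul y (mul x (mul y ρ)))) ×
     fixedPoints (mul x (mul x (mul y (mul y ρ)))) ≡ fixedPoints (mul y (mul x (mul y (mul x ρ)))))
doubled-classes = from-yes (all? λ x → all? λ y → all? λ ρ →
  transp? x →-dec transp? y →-dec ¬? (x ≟ y) →-dec sign ρ ℙ.≟ 0ℙ →-dec
  ¬? (fixedPoints (mul x (mul x (mul y (mul y ρ)))) ℕ.≟ fixedPoints (mul x (mul y (mul x (mul y ρ)))) ×-dec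
      fixedPoints (mul x (mul x (mul y (mul y ρ)))) ℕ.≟ fixedPoints (mul y (mul x (mul y (mul x ρ))))))

doubled-obstruction : ∀ {ks x y} → All Transp ks → parity (length ks) ≡ 0ℙ → Transp x → Transp y → x ≢ y →
  2 ≤ count x ks → 2 ≤ count y ks → ¬ Invariant ks
doubled-obstruction {ks} {x} {y} ts even tx ty x≢y x-twice y-twice invariant =
  obstruct (rearrange-prefix (x ∷ x ∷ y ∷ y ∷ []) ks λ q → enough (x ≟ q) (y ≟ q))
  where
    enough : ∀ {q} → Dec (x ≡ q) → Dec (y ≡ q) → count q (x ∷ x ∷ y ∷ y ∷ []) ≤ count q ks
    enough         (yes refl) (yes refl) = ⊥-elim (x≢y refl)
    enough         (yes refl) (no y≢x)   = subst (_≤ count x ks)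
      (sym (trans (count-twice x _) (cong (λ n → suc (suc n)) (count-skip-twice [] y≢x)))) x-twice
    enough         (no x≢y)   (yes refl) = subst (_≤ count y ks)
      (sym (trans (count-skip-twice _ x≢y) (count-twice y []))) y-twice
    enough {q}     (no x≢q)   (no y≢q)   = subst (_≤ count q ks)
      (sym (trans (count-skip-twice _ x≢q) (count-skip-twice [] y≢q))) z≤n
    obstruct : (∃ λ rs → ks ↭ x ∷ x ∷ y ∷ y ∷ rs) → ⊥
    obstruct (rs , ks↭) = doubled-classes x y (product rs) tx ty x≢y rest-even (same-class invariant w₀ w₁ , same-class invariant w₀ w₂)
      where
        w₀ : x ∷ x ∷ y ∷ y ∷ rs ↭ ks
        w₀ = ↭-sym ks↭
        w₁ : x ∷ y ∷ x ∷ y ∷ rs ↭ ks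
        w₁ = ↭-trans (prep x (swap y x ↭-refl)) w₀
        w₂ : y ∷ x ∷ y ∷ x ∷ rs ↭ ks
        w₂ = ↭-trans (swap y x (swap y x ↭-refl)) w₁
        rest-even : sign (product rs) ≡ 0ℙ
        rest-even = trans (sign-product (AllP.++⁻ʳ (x ∷ x ∷ y ∷ y ∷ []) (↭.All-resp-↭ ks↭ ts)))
          (trans (cong parity (↭.↭-length w₀)) even)

-- k is a power of the involution y, i.e. y^a for some a ∈ {0,1}.
PowerOf : S3 → S3 → Set
PowerOf y k = k ≡ e ⊎ k ≡ y

power? : ∀ y k → Dec (PowerOf y k)
power? y k = k ≟ e ⊎-dec k ≟ y

power-step : ∀ y k → Transp y → PowerOf y k → PowerOf y (mul y k)
power-step = from-yes (all? λ y → all? λ k → transp? y →-dec power? y k →-dec power? y (mul y k))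

power-word : ∀ {x y rs} → Transp y → All (λ k → k ≡ x ⊎ k ≡ y) rs → All (_≢ x) rs → PowerOf y (product rs)
power-word ty []               []         = inj₁ refl
power-word ty (inj₁ refl ∷ _)  (x≢x ∷ _)  = ⊥-elim (x≢x refl)
power-word ty (inj₂ refl ∷ ls) (_ ∷ no-x) = power-step _ _ ty (power-word ty ls no-x)

single-x-word : ∀ {x y rs} → Transp y → x ≢ y → All (λ k → k ≡ x ⊎ k ≡ y) rs → count x rs ≡ 1 →
  ∃₂ λ k l → PowerOf y k × PowerOf y l × product rs ≡ mul k (mul x l)
single-x-word ty x≢y [] ()
single-x-word {x} {rs = _ ∷ rs} ty x≢y (inj₁ refl ∷ ls) once =
  e , product rs , inj₁ refl , power-word ty ls (absent (ℕ.suc-injective (trans (sym (count-here rs refl)) once))) ,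
  sym (mul-identityˡ _)
single-x-word {x} {y} {_ ∷ rs} ty x≢y (inj₂ refl ∷ ls) once =
  let k , l , pk , pl , rs≡ = single-x-word ty x≢y ls (trans (sym (count-there rs λ y≡x → x≢y (sym y≡x))) once)
  in mul y k , l , power-step y k ty pk , pl , (begin
       mul y (product rs)           ≡⟨ cong (mul y) rs≡ ⟩
       mul y (mul k (mul x l))      ≡⟨ sym (mul-assoc y k (mul x l)) ⟩
       mul (mul y k) (mul x l)      ∎)
  where open ≡-Reasoning

single-x-class : ∀ x y k l → Transp x → Transp y → x ≢ y → PowerOf y k → PowerOf y l →
  sign (mul k (mul x l)) ≡ 0ℙ → fixedPoints (mul k (mul x l)) ≡ 0
single-x-class = from-yes (all? λ x → all? λ y → all? λ k → all? λ l →
  transp? x →-dec transp? y →-dec ¬? (x ≟ y) →-dec power? y k →-dec power? y l →-dec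
  sign (mul k (mul x l)) ℙ.≟ 0ℙ →-dec fixedPoints (mul k (mul x l)) ℕ.≟ 0)

third-transp : ∀ x z → Transp x → Transp z → x ≢ z →
  ∃ λ y → Transp y × x ≢ y × (∀ t → Transp t → t ≢ z → t ≡ x ⊎ t ≡ y)
third-transp = from-yes (all? λ x → all? λ z → transp? x →-dec transp? z →-dec ¬? (x ≟ z) →-dec
  any? λ y → transp? y ×-dec ¬? (x ≟ y) ×-dec
    all? λ t → transp? t →-dec ¬? (t ≟ z) →-dec (t ≟ x ⊎-dec t ≟ y))

-- An even sequence in which a transposition z is absent and another one x
-- occurs exactly once is invariant: every rearrangement gives a 3-cycle.
single-x-invariant : ∀ {ks x z} → All Transp ks → parity (length ks) ≡ 0ℙ → Transp x → Transp z → x ≢ z →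
  count x ks ≡ 1 → count z ks ≡ 0 → Invariant ks
single-x-invariant {ks} {x} {z} ts even tx tz x≢z once none = invariant (third-transp x z tx tz x≢z)
  where
    invariant : (∃ λ y → Transp y × x ≢ y × (∀ t → Transp t → t ≢ z → t ≡ x ⊎ t ≡ y)) → Invariant ks
    invariant (y , ty , x≢y , only-x-y) rs rs↭ = trans (three-cycle rs↭) (sym (three-cycle ↭-refl))
      where
        three-cycle : ∀ {rs} → rs ↭ ks → fixedPoints (product rs) ≡ 0
        three-cycle {rs} rs↭ = classify (single-x-word ty x≢y letters (trans (count-↭ x rs↭) once))
          where
            trs : All Transp rs
            trs = ↭.All-resp-↭ (↭-sym rs↭) ts
            letters : All (λ k → k ≡ x ⊎ k ≡ y) rs
            letters = All.zipWith (λ (tk , k≢z) → only-x-y _ tk k≢z) (trs , absent (trans (count-↭ z rs↭) none))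
            rs-even : sign (product rs) ≡ 0ℙ
            rs-even = trans (sign-product trs) (trans (cong parity (↭.↭-length rs↭)) even)
            classify : (∃₂ λ k l → PowerOf y k × PowerOf y l × product rs ≡ mul k (mul x l)) →
              fixedPoints (product rs) ≡ 0
            classify (k , l , pk , pl , rs≡) = subst (λ p → fixedPoints p ≡ 0) (sym rs≡)
              (single-x-class x y k l tx ty x≢y pk pl (subst (λ p → sign p ≡ 0ℙ) rs≡ rs-even))

multiplicity≡count : ∀ u i j → multiplicity u i j ≡ count (edge i j) (kinds u)
multiplicity≡count []      i j = refl
multiplicity≡count (σ ∷ u) i j = by-cases (σ ≈ₚ? transpose i j)
  where
    open ≡-Reasoning
    kind⇔ : σ ≈ₚ transpose i j ⇔ code σ ≡ edge i j
    kind⇔ = ≈ₚ⇔code σ (transpose i j)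
    by-cases : Dec (σ ≈ₚ transpose i j) → multiplicity (σ ∷ u) i j ≡ count (edge i j) (kinds (σ ∷ u))
    by-cases (yes σ≈) = begin
      multiplicity (σ ∷ u) i j           ≡⟨ cong length (filter-accept (λ τ → τ ≈ₚ? transpose i j) σ≈) ⟩
      suc (multiplicity u i j)           ≡⟨ cong suc (multiplicity≡count u i j) ⟩
      suc (count (edge i j) (kinds u))   ≡⟨ sym (count-here (kinds u) (Equivalence.to kind⇔ σ≈)) ⟩
      count (edge i j) (kinds (σ ∷ u))   ∎
    by-cases (no σ≉) = begin
      multiplicity (σ ∷ u) i j           ≡⟨ cong length (filter-reject (λ τ → τ ≈ₚ? transpose i j) σ≉) ⟩
      multiplicity u i j                 ≡⟨ multiplicity≡count u i j ⟩
      count (edge i j) (kinds u)         ≡⟨ sym (count-there (kinds u) λ same → σ≉ (Equivalence.from kind⇔ same)) ⟩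
      count (edge i j) (kinds (σ ∷ u))   ∎

adjacent : ∀ u {i j} → i ≢ j → 1 ≤ count (edge i j) (kinds u) → Adj u i j
adjacent u {i} {j} i≢j occurs = i≢j , subst (1 ≤_) (sym (multiplicity≡count u i j)) occurs

adjacent-occurs : ∀ u {i j} → Adj u i j → 1 ≤ count (edge i j) (kinds u)
adjacent-occurs u {i} {j} (_ , occurs) = subst (1 ≤_) (multiplicity≡count u i j) occurs

three-vertices : ∀ (a b c : Fin 3) → a ≢ b → a ≢ c → b ≢ c → ∀ i → i ≡ a ⊎ i ≡ b ⊎ i ≡ c
three-vertices = from-yes (all? λ (a : Fin 3) → all? λ b → all? λ c →
  ¬? (a ≟ b) →-dec ¬? (a ≟ c) →-dec ¬? (b ≟ c) →-dec all? λ i → i ≟ a ⊎-dec i ≟ b ⊎-dec i ≟ c)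

triangle-joins : ∀ {E : Fin 3 → Fin 3 → Set} {a b c} → a ≢ b → a ≢ c → b ≢ c →
  E a b → E b c → E c a → ∀ i j → i ≢ j → E i j ⊎ E j i
triangle-joins {E = E} {a} {b} {c} a≢b a≢c b≢c ab bc ca i j i≢j =
  join (three-vertices a b c a≢b a≢c b≢c i) (three-vertices a b c a≢b a≢c b≢c j)
  where
    join : i ≡ a ⊎ i ≡ b ⊎ i ≡ c → j ≡ a ⊎ j ≡ b ⊎ j ≡ c → E i j ⊎ E j i
    join (inj₁ refl)        (inj₁ refl)        = ⊥-elim (i≢j refl)
    join (inj₁ refl)        (inj₂ (inj₁ refl)) = inj₁ ab
    join (inj₁ refl)        (inj₂ (inj₂ refl)) = inj₂ ca
    join (inj₂ (inj₁ refl)) (inj₁ refl)        = inj₂ ab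
    join (inj₂ (inj₁ refl)) (inj₂ (inj₁ refl)) = ⊥-elim (i≢j refl)
    join (inj₂ (inj₁ refl)) (inj₂ (inj₂ refl)) = inj₁ bc
    join (inj₂ (inj₂ refl)) (inj₁ refl)        = inj₁ ca
    join (inj₂ (inj₂ refl)) (inj₂ (inj₁ refl)) = inj₂ bc
    join (inj₂ (inj₂ refl)) (inj₂ (inj₂ refl)) = ⊥-elim (i≢j refl)

-- A cycle in a graph on {0,1,2} has exactly three vertices, so it joins every pair.
cycle-joins : ∀ {E : Fin 3 → Fin 3 → Set} → Cycle E → ∀ i j → i ≢ j → E i j ⊎ E j i
cycle-joins record { rest = [] ; long = () }
cycle-joins record { rest = _ ∷ [] ; long = s≤s () }
cycle-joins record { start = a ; rest = b ∷ c ∷ d ∷ _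
                   ; dist = (a≢b ∷ a≢c ∷ a≢d ∷ _) ∷ (b≢c ∷ b≢d ∷ _) ∷ (c≢d ∷ _) ∷ _ } _ _ _ =
  ⊥-elim ([ (λ d≡a → a≢d (sym d≡a)) , [ (λ d≡b → b≢d (sym d≡b)) , (λ d≡c → c≢d (sym d≡c)) ]′ ]′
           (three-vertices a b c a≢b a≢c b≢c d))
cycle-joins record { start = a ; rest = b ∷ c ∷ []
                   ; dist = (a≢b ∷ a≢c ∷ []) ∷ (b≢c ∷ []) ∷ [] ∷ [] ; walk = ab , bc , ca } =
  triangle-joins a≢b a≢c b≢c ab bc ca

hub-connected : ∀ {n} {E : Fin n → Fin n → Set} h → (∀ v → v ≢ h → E h v × E v h) → Connected E
hub-connected {E = E} h spoke x y = to-hub (x ≟ h) ◅◅ from-hub (y ≟ h)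
  where
    to-hub : ∀ {x} → Dec (x ≡ h) → Star E x h
    to-hub (yes refl) = ε
    to-hub (no x≢h)   = proj₂ (spoke _ x≢h) ◅ ε
    from-hub : ∀ {y} → Dec (y ≡ h) → Star E h y
    from-hub (yes refl) = ε
    from-hub (no y≢h)   = proj₁ (spoke _ y≢h) ◅ ε

triangle-cycle : ∀ u → (∀ p → Transp p → 1 ≤ count p (kinds u)) → Cycle (Adj u)
triangle-cycle u all-occur = record
  { start = 0F ; rest = 1F ∷ 2F ∷ [] ; long = s≤s (s≤s z≤n)
  ; dist  = ((λ ()) ∷ (λ ()) ∷ []) ∷ ((λ ()) ∷ []) ∷ [] ∷ []
  ; walk  = adjacent u (λ ()) (all-occur t₀₁ refl) , adjacent u (λ ()) (all-occur t₁₂ refl) ,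
            adjacent u (λ ()) (all-occur t₀₂ refl) }

fixed-vertex : ∀ p → Transp p → ∃ λ h → ap p h ≡ h
fixed-vertex = from-yes (all? λ p → transp? p →-dec any? λ h → ap p h ≟ h)

-- If the transposition z is absent and the other two occur, T(u) is a path
-- through the fixed point of z, hence a multitree.
path-multitree : ∀ u {z} → Transp z → count z (kinds u) ≡ 0 →
  (∀ p → Transp p → p ≢ z → 1 ≤ count p (kinds u)) → IsMultitree u
path-multitree u {z} tz none others = centre (fixed-vertex z tz) , acyclic (edge-ends z tz)
  where
    missing : ∀ {p} → p ≡ z → ¬ (1 ≤ count p (kinds u))
    missing refl occurs = ℕ.1+n≰n (subst (1 ≤_) none occurs)
    acyclic : (∃₂ λ i j → i ≢ j × edge i j ≡ z) → Acyclic (Adj u)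
    acyclic (i , j , i≢j , ij≡z) cycle =
      [ (λ adj → missing ij≡z (adjacent-occurs u adj))
      , (λ adj → missing (trans (edge-sym j i) ij≡z) (adjacent-occurs u adj)) ]′ (cycle-joins cycle i j i≢j)
    centre : (∃ λ h → ap z h ≡ h) → Connected (Adj u)
    centre (h , z-fixes-h) = hub-connected h spoke
      where
        spoke : ∀ v → v ≢ h → Adj u h v × Adj u v h
        spoke v v≢h = adjacent u h≢v occurs , adjacent u v≢h (subst (λ p → 1 ≤ count p (kinds u)) (edge-sym h v) occurs)
          where
            h≢v : h ≢ v
            h≢v h≡v = v≢h (sym h≡v)
            hv≢z : edge h v ≢ z
            hv≢z hv≡z = h≢v (begin
              h                ≡⟨ sym z-fixes-h ⟩
              ap z h           ≡⟨ cong (λ p → ap p h) (sym hv≡z) ⟩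
              ap (edge h v) h  ≡⟨ edge-moves h v h≢v ⟩
              v                ∎)
              where open ≡-Reasoning
            occurs : 1 ≤ count (edge h v) (kinds u)
            occurs = others (edge h v) (edge-transp h v h≢v) hv≢z

Covering : List S3 → Set
Covering ks = ∀ w → ∃ λ p → p ∈ ks × ap p w ≢ w

covering : ∀ u → (∀ i → Σ Sym3 λ σ → σ ∈ u × InSupport i σ) → Covering (kinds u)
covering u covers w with covers w
... | σ , σ∈u , moves = code σ , ∈-map⁺ code σ∈u , λ fixes → moves (trans (code-correct σ w) fixes)

shared-vertex : ∀ p z → Transp p → Transp z → p ≢ z →
  ∃ λ w → ∀ s → Transp s → ap s w ≢ w → s ≡ p ⊎ s ≡ z
shared-vertex = from-yes (all? λ p → all? λ z → transp? p →-dec transp? z →-dec ¬? (p ≟ z) →-dec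
  any? λ w → all? λ s → transp? s →-dec ¬? (ap s w ≟ w) →-dec (s ≟ p ⊎-dec s ≟ z))

others-occur : ∀ {ks z} → All Transp ks → Covering ks → Transp z → count z ks ≡ 0 →
  ∀ p → Transp p → p ≢ z → 1 ≤ count p ks
others-occur {ks} ts cover tz none p tp p≢z = through (shared-vertex p _ tp tz p≢z)
  where
    through : (∃ λ w → ∀ s → Transp s → ap s w ≢ w → s ≡ p ⊎ s ≡ _) → 1 ≤ count p ks
    through (w , moved-only-by) = mover (cover w)
      where
        mover : (∃ λ s → s ∈ ks × ap s w ≢ w) → 1 ≤ count p ks
        mover (s , s∈ks , moves) =
          [ (λ s≡p → subst (λ q → 1 ≤ count q ks) s≡p (member-counts s∈ks))
          , (λ s≡z → ⊥-elim (ℕ.1+n≰n (subst (1 ≤_) none (subst (λ q → 1 ≤ count q ks) s≡z (member-counts s∈ks)))))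
          ]′ (moved-only-by s (All.lookup ts s∈ks) moves)

all-or-absent : ∀ ks → (∀ p → Transp p → 1 ≤ count p ks) ⊎ ∃ λ z → Transp z × count z ks ≡ 0
all-or-absent ks with any? (λ z → transp? z ×-dec count z ks ℕ.≟ 0)
... | yes absent-kind = inj₂ absent-kind
... | no  none-absent = inj₁ λ p tp → ℕ.n≢0⇒n>0 λ p-absent → none-absent (p , tp , p-absent)

simple-multiedge : ∀ u {x} → Transp x → count x (kinds u) ≡ 1 → HasSimpleMultiedge u
simple-multiedge u {x} tx once = labelled (edge-ends x tx)
  where
    labelled : (∃₂ λ i j → i ≢ j × edge i j ≡ x) → HasSimpleMultiedge u
    labelled (i , j , i≢j , ij≡x) =
      i , j , i≢j , trans (multiplicity≡count u i j) (trans (cong (λ p → count p (kinds u)) ij≡x) once)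

other-transps : ∀ z → Transp z → ∃₂ λ x y → Transp x × Transp y × x ≢ y × x ≢ z × y ≢ z
other-transps = from-yes (all? λ z → transp? z →-dec any? λ x → any? λ y →
  transp? x ×-dec transp? y ×-dec ¬? (x ≟ y) ×-dec ¬? (x ≟ z) ×-dec ¬? (y ≟ z))

transposition-kinds : ∀ {u} → All IsTransposition u → All Transp (kinds u)
transposition-kinds transpositions = AllP.map⁺ (All.map (λ {σ} → transposition-code {σ}) transpositions)

parity-kinds : ∀ u → parity (length (kinds u)) ≡ parity (length u)
parity-kinds u = cong parity (length-map code u)

odd-sequence-invariant : ∀ {u} → All IsTransposition u → parity (length u) ≡ 1ℙ → ConjugacyInvariant u
odd-sequence-invariant {u} transpositions odd =
  Equivalence.from (invariant⇔ u) (odd-invariant (transposition-kinds transpositions) (trans (parity-kinds u) odd))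

even-necessary : ∀ u → All IsTransposition u → (∀ i → Σ Sym3 λ σ → σ ∈ u × InSupport i σ) →
  parity (length u) ≡ 0ℙ → ConjugacyInvariant u → IsMultitree u × HasSimpleMultiedge u
even-necessary u transpositions covers even-u ci = by-kinds (all-or-absent (kinds u))
  where
    ts : All Transp (kinds u)
    ts = transposition-kinds transpositions
    even : parity (length (kinds u)) ≡ 0ℙ
    even = trans (parity-kinds u) even-u
    invariant : Invariant (kinds u)
    invariant = Equivalence.to (invariant⇔ u) ci
    simple : ∀ {x y} → x ≢ y → Transp x → Transp y →
      2 ≤ count x (kinds u) ⊎ 1 ≡ count x (kinds u) → 2 ≤ count y (kinds u) ⊎ 1 ≡ count y (kinds u) →
      HasSimpleMultiedge u
    simple _   tx _  (inj₂ x-once)  _              = simple-multiedge u tx (sym x-once)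
    simple _   _  ty _              (inj₂ y-once)  = simple-multiedge u ty (sym y-once)
    simple x≢y tx ty (inj₁ x-twice) (inj₁ y-twice) =
      ⊥-elim (doubled-obstruction ts even tx ty x≢y x-twice y-twice invariant)
    by-kinds : (∀ p → Transp p → 1 ≤ count p (kinds u)) ⊎ (∃ λ z → Transp z × count z (kinds u) ≡ 0) →
      IsMultitree u × HasSimpleMultiedge u
    by-kinds (inj₁ all-occur)       = ⊥-elim (triangle-obstruction ts even all-occur invariant)
    by-kinds (inj₂ (z , tz , none)) = path (other-transps z tz)
      where
        present : ∀ p → Transp p → p ≢ z → 1 ≤ count p (kinds u)
        present = others-occur ts (covering u covers) tz none
        path : (∃₂ λ x y → Transp x × Transp y × x ≢ y × x ≢ z × y ≢ z) → IsMultitree u × HasSimpleMultiedge u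
        path (x , y , tx , ty , x≢y , x≢z , y≢z) = path-multitree u tz none present ,
          simple x≢y tx ty (ℕ.m≤n⇒m<n∨m≡n (present x tx x≢z)) (ℕ.m≤n⇒m<n∨m≡n (present y ty y≢z))

even-sufficient : ∀ u → All IsTransposition u → parity (length u) ≡ 0ℙ →
  IsMultitree u → HasSimpleMultiedge u → ConjugacyInvariant u
even-sufficient u transpositions even-u (_ , acyclic) (i , j , i≢j , simple) =
  Equivalence.from (invariant⇔ u) (by-kinds (all-or-absent (kinds u)))
  where
    once : count (edge i j) (kinds u) ≡ 1
    once = trans (sym (multiplicity≡count u i j)) simple
    by-kinds : (∀ p → Transp p → 1 ≤ count p (kinds u)) ⊎ (∃ λ z → Transp z × count z (kinds u) ≡ 0) →
      Invariant (kinds u)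
    by-kinds (inj₁ all-occur)       = ⊥-elim (acyclic (triangle-cycle u all-occur))
    by-kinds (inj₂ (z , tz , none)) = single-x-invariant (transposition-kinds transpositions)
      (trans (parity-kinds u) even-u) (edge-transp i j i≢j) tz ij≢z once none
      where
        ij≢z : edge i j ≢ z
        ij≢z ij≡z = ℕ.0≢1+n (trans (sym none) (trans (cong (λ p → count p (kinds u)) (sym ij≡z)) once))

theorem3p5 : (u : List Sym3) → All IsTransposition u →
    (∀ (i : Fin 3) → Σ Sym3 λ σ → σ ∈ u × InSupport i σ) →
    (ConjugacyInvariant u ⇔ (length u % 2 ≡ 1 ⊎ (IsMultitree u × HasSimpleMultiedge u)))
theorem3p5 u transpositions covers with parity (length u) in parity-u
... | 1ℙ = mk⇔ (λ _ → inj₁ (Equivalence.from (odd⇔parity (length u)) parity-u))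
               (λ _ → odd-sequence-invariant transpositions parity-u)
... | 0ℙ = mk⇔ (λ ci → inj₂ (even-necessary u transpositions covers parity-u ci))
               [ (λ odd → ⊥-elim (ℙ.p≢p⁻¹ 0ℙ (trans (sym parity-u) (Equivalence.to (odd⇔parity (length u)) odd))))
               , (λ (tree , simple) → even-sufficient u transpositions parity-u tree simple) ]′
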